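{- Let $\{G_n^*(x)\}$ (of Lucas type) and $\{G_n'(x)\}$ (of Fibonacci type) be equivalent generalized Fibonacci polynomial sequences, and let $\alpha=2/G_0^*(x)$. If $m\ge 0$ and $n\ge 0$, then (1) $(d(x)^2+4g(x))\,G'_{m+n+1}(x)=\alpha^2G^*_{m+1}(x)G^*_{n+1}(x)+\alpha^2g(x)G^*_m(x)G^*_n(x)$; (2) $G^*_{m+n+2}(x)=\alpha G^*_{m+1}(x)G^*_{n+1}(x)+g(x)\big[\alpha G^*_m(x)G^*_n(x)-G^*_{m+n}(x)\big]$.
   Context: All polynomials lie in $\mathbb{Z}[x]$. A generalized Fibonacci polynomial (GFP) sequence $\{G_n(x)\}_{n\ge0}$ is given by $G_0(x)=p_0(x)$, $G_1(x)=p_1(x)$ and $G_n(x)=d(x)G_{n-1}(x)+g(x)G_{n-2}(x)$ for $n\ge 2$, where $p_0(x)$ is a constant and $p_1(x),d(x),g(x)$ are nonzero polynomials in $\mathbb{Z}[x]$ with $\gcd(d(x),g(x))=1$; as in the paper it is assumed that $d(x)^2+4g(x)>0$. Let $a,b$ be the roots of $z^2-d(x)z-g(x)=0$, so $(a-b)^2=d(x)^2+4g(x)$. The sequence is of Lucas type if $p_0\ne 0$, $2p_1(x)=p_0\,d(x)$, $|p_0|\in\{1,2\}$, and $\gcd(p_0,p_1(x))=\gcd(p_0,d(x))=\gcd(p_0,g(x))=1$; then, with $\alpha=2/p_0$, $G_n=(a^n+b^n)/\alpha$ (denoted $G_n^*$). It is of Fibonacci type if $p_0=0$ and $p_1=1$;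 then $G_n=(a^n-b^n)/(a-b)$ (denoted $G_n'$). A Lucas-type and a Fibonacci-type sequence are equivalent if they are defined with the same $d(x)$ and $g(x)$. -}

module Defs where

open import Data.Integer using (ℤ; +_; -_; _+_; _*_; _>_; ∣_∣; 0ℤ; 1ℤ)
open import Data.Nat using (ℕ; zero; suc)
open import Data.List using (List; []; _∷_)
open import Data.Product using (∃; _×_)
open import Data.Sum using (_⊎_)
open import Relation.Binary.PropositionalEquality using (_≡_)
open import Relation.Nullary using (¬_)

-- Polynomials in ℤ[x] as coefficient lists, lowest degree first.
-- Trailing zeros are allowed; equality is coefficientwise (_≈ₚ_).
Poly : Set
Poly = List ℤ

coeff : Poly → ℕ → ℤ
coeff []       _       = 0ℤ
coeff (c ∷ _)  zero    = c
coeff (_ ∷ p)  (suc i) = coeff p i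

_≈ₚ_ : Poly → Poly → Set
p ≈ₚ q = ∀ i → coeff p i ≡ coeff q i

infix 4 _≈ₚ_
infixl 6 _+ₚ_ _-ₚ_
infixl 7 _*ₚ_ _·ₚ_

const : ℤ → Poly
const c = c ∷ []

0ₚ 1ₚ : Poly
0ₚ = []
1ₚ = const 1ℤ

_+ₚ_ : Poly → Poly → Poly
[]      +ₚ q       = q
(a ∷ p) +ₚ []      = a ∷ p
(a ∷ p) +ₚ (b ∷ q) = (a + b) ∷ (p +ₚ q)

_·ₚ_ : ℤ → Poly → Poly
c ·ₚ []      = []
c ·ₚ (a ∷ p) = (c * a) ∷ (c ·ₚ p)

negₚ : Poly → Poly
negₚ p = (- 1ℤ) ·ₚ p

_-ₚ_ : Poly → Poly → Poly
p -ₚ q = p +ₚ negₚ q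

_*ₚ_ : Poly → Poly → Poly
[]      *ₚ q = []
(a ∷ p) *ₚ q = (a ·ₚ q) +ₚ (0ℤ ∷ (p *ₚ q))

eval : Poly → ℤ → ℤ
eval []      x = 0ℤ
eval (a ∷ p) x = a + x * eval p x

_∣ₚ_ : Poly → Poly → Set
h ∣ₚ p = ∃ λ q → p ≈ₚ h *ₚ q

Coprimeₚ : Poly → Poly → Set
Coprimeₚ p q = ∀ h → h ∣ₚ p → h ∣ₚ q → (h ≈ₚ 1ₚ) ⊎ (h ≈ₚ negₚ 1ₚ)

-- d(x)^2 + 4 g(x) > 0, read as: positive at every integer x
Positive : Poly → Set
Positive p = ∀ x → eval p x > 0ℤ

GFP : (d g p₀ p₁ : Poly) → ℕ → Poly
GFP d g p₀ p₁ zero          = p₀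
GFP d g p₀ p₁ (suc zero)    = p₁
GFP d g p₀ p₁ (suc (suc n)) = d *ₚ GFP d g p₀ p₁ (suc n) +ₚ g *ₚ GFP d g p₀ p₁ n

Admissible : (d g : Poly) → Set
Admissible d g = ¬ (d ≈ₚ 0ₚ) × ¬ (g ≈ₚ 0ₚ) × Coprimeₚ d g × Positive (d *ₚ d +ₚ (+ 4) ·ₚ g)

LucasType : (d g : Poly) (p₀ : ℤ) (p₁ : Poly) → Set
LucasType d g p₀ p₁ =
  ¬ (p₁ ≈ₚ 0ₚ) ×
  ¬ (p₀ ≡ 0ℤ) ×
  ((+ 2) ·ₚ p₁ ≈ₚ p₀ ·ₚ d) ×
  ((∣ p₀ ∣ ≡ 1) ⊎ (∣ p₀ ∣ ≡ 2)) ×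
  Coprimeₚ (const p₀) p₁ × Coprimeₚ (const p₀) d × Coprimeₚ (const p₀) g

GLucas : (d g : Poly) (p₀ : ℤ) (p₁ : Poly) → ℕ → Poly
GLucas d g p₀ p₁ = GFP d g (const p₀) p₁

GFib : (d g : Poly) → ℕ → Poly
GFib d g = GFP d g 0ₚ 1ₚ

-- Put L_n = α G*_n = a^n + b^n, so that L and the Fibonacci-type sequence F = G′ both satisfy
-- X_{n+2} = d X_{n+1} + g X_n, with L_0 = 2, L_1 = d, F_0 = 0, F_1 = 1. For any two such
-- sequences S and T the expression S_{m+1} T_{n+1} + g S_m T_n depends only on m + n, since
-- moving one step from S to T uses the recurrence once on each side. With S = T = L this gives
-- L_{m+1} L_{n+1} + g L_m L_n = d L_{m+n+1} + 2g L_{m+n}, which is (2) after one more use of the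
-- recurrence; with S = L and T = F it gives L_{k+1} = d F_{k+1} + 2g F_k and L_k + d F_k = 2 F_{k+1},
-- from which (d² + 4g) F_{k+1} = d L_{k+1} + 2g L_k, i.e. (1). All of this holds in any
-- commutative ring; for ℤ[x] one finally divides by α.

module Submission where

open import Defs
open import Algebra.Bundles using (CommutativeMonoid; CommutativeRing)
open import Data.Integer using (ℤ; +_; 0ℤ; 1ℤ; -1ℤ) renaming (_*_ to _*ℤ_)
import Data.Integer as ℤ
import Data.Integer.Properties as ℤ
open import Data.List using ([]; _∷_)
open import Data.Nat using (ℕ; zero; suc)
import Data.Nat as ℕ
import Data.Nat.Properties as ℕ
open import Data.Product using (_×_; _,_)
open import Level using (0ℓ)
open import Relation.Binary.PropositionalEquality as ≡ using (_≡_; _≢_)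
open import Relation.Binary.Structures using (IsEquivalence)

module Recurrence {c ℓ} (R : CommutativeRing c ℓ) (d g : CommutativeRing.Carrier R) where

  open CommutativeRing R
  open import Algebra.Properties.Group +-group using (∙-cancelʳ; x≈z//y)
  open import Algebra.Properties.Ring ring using (x[y-z]≈xy-xz)
  open import Algebra.Solver.Ring.NaturalCoefficients.Default commutativeSemiring
  open import Relation.Binary.Reasoning.Setoid setoid

  -- In the solver equations below, con 2 evaluates to 2# definitionally.
  2# : Carrier
  2# = 1# + 1#

  Δ : Carrier
  Δ = d * d + (2# + 2#) * g

  Recurrent : (ℕ → Carrier) → Set ℓ
  Recurrent S = ∀ k → S (suc (suc k)) ≈ d * S (suc k) + g * S k

  *-recurrent : ∀ a {S} → Recurrent S → Recurrent (λ k → a * S k)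
  *-recurrent a {S} S-rec k = begin
    a * S (suc (suc k))                 ≈⟨ *-congˡ (S-rec k) ⟩
    a * (d * S (suc k) + g * S k)       ≈⟨ solve 5 (λ a d g x y → a :* (d :* x :+ g :* y)
                                                             := d :* (a :* x) :+ g :* (a :* y))
                                                 refl a d g (S (suc k)) (S k) ⟩
    d * (a * S (suc k)) + g * (a * S k) ∎

  cross : (S T : ℕ → Carrier) → ℕ → ℕ → Carrier
  cross S T m n = S (suc m) * T (suc n) + g * (S m * T n)

  module _ {S T : ℕ → Carrier} (S-rec : Recurrent S) (T-rec : Recurrent T) where

    cross-suc : ∀ m n → cross S T (suc m) n ≈ cross S T m (suc n)
    cross-suc m n = begin
      S (suc (suc m)) * T (suc n) + g * (S (suc m) * T n)
        ≈⟨ +-congʳ (*-congʳ (S-rec m)) ⟩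
      (d * S (suc m) + g * S m) * T (suc n) + g * (S (suc m) * T n)
        ≈⟨ solve 6 (λ d g s₀ s₁ t₀ t₁ → (d :* s₁ :+ g :* s₀) :* t₁ :+ g :* (s₁ :* t₀)
                                        := s₁ :* (d :* t₁ :+ g :* t₀) :+ g :* (s₀ :* t₁))
                   refl d g (S m) (S (suc m)) (T n) (T (suc n)) ⟩
      S (suc m) * (d * T (suc n) + g * T n) + g * (S m * T (suc n))
        ≈⟨ +-congʳ (*-congˡ (T-rec n)) ⟨
      S (suc m) * T (suc (suc n)) + g * (S m * T (suc n)) ∎

    cross-sum : ∀ m n → cross S T m n ≈ cross S T 0 (m ℕ.+ n)
    cross-sum zero    n = refl
    cross-sum (suc m) n = begin
      cross S T (suc m) n       ≈⟨ cross-suc m n ⟩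
      cross S T m (suc n)       ≈⟨ cross-sum m (suc n) ⟩
      cross S T 0 (m ℕ.+ suc n) ≡⟨ ≡.cong (cross S T 0) (ℕ.+-suc m n) ⟩
      cross S T 0 (suc m ℕ.+ n) ∎

  module LucasFibonacci {L F : ℕ → Carrier} (L-rec : Recurrent L) (F-rec : Recurrent F)
    (L₀ : L 0 ≈ 2#) (L₁ : L 1 ≈ d) (F₀ : F 0 ≈ 0#) (F₁ : F 1 ≈ 1#) where

    lucas-suc-via-fibonacci : ∀ k → L (suc k) ≈ d * F (suc k) + g * (2# * F k)
    lucas-suc-via-fibonacci k = begin
      L (suc k)                         ≈⟨ solve 3 (λ g l l′ → l := l :* con 1 :+ g :* (l′ :* con 0))
                                                   refl g (L (suc k)) (L k) ⟩
      L (suc k) * 1# + g * (L k * 0#)   ≈⟨ +-cong (*-congˡ F₁) (*-congˡ (*-congˡ F₀)) ⟨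
      cross L F k 0                     ≈⟨ cross-sum L-rec F-rec k 0 ⟩
      cross L F 0 (k ℕ.+ 0)             ≡⟨ ≡.cong (cross L F 0) (ℕ.+-identityʳ k) ⟩
      L 1 * F (suc k) + g * (L 0 * F k) ≈⟨ +-cong (*-congʳ L₁) (*-congˡ (*-congʳ L₀)) ⟩
      d * F (suc k) + g * (2# * F k)    ∎

    lucas-via-fibonacci : ∀ k → L k + d * F k ≈ 2# * F (suc k)
    lucas-via-fibonacci zero = begin
      L 0 + d * F 0 ≈⟨ +-cong L₀ (*-congˡ F₀) ⟩
      2# + d * 0#   ≈⟨ solve 1 (λ d → con 2 :+ d :* con 0 := con 2 :* con 1) refl d ⟩
      2# * 1#       ≈⟨ *-congˡ F₁ ⟨
      2# * F 1      ∎
    lucas-via-fibonacci (suc k) = begin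
      L (suc k) + d * F (suc k)
        ≈⟨ +-congʳ (lucas-suc-via-fibonacci k) ⟩
      d * F (suc k) + g * (2# * F k) + d * F (suc k)
        ≈⟨ solve 4 (λ d g x y → d :* x :+ g :* (con 2 :* y) :+ d :* x := con 2 :* (d :* x :+ g :* y))
                   refl d g (F (suc k)) (F k) ⟩
      2# * (d * F (suc k) + g * F k)
        ≈⟨ *-congˡ (F-rec k) ⟨
      2# * F (suc (suc k)) ∎

    lucas-cross : ∀ m n → cross L L m n ≈ d * L (suc (m ℕ.+ n)) + g * (2# * L (m ℕ.+ n))
    lucas-cross m n = trans (cross-sum L-rec L-rec m n) (+-cong (*-congʳ L₁) (*-congˡ (*-congʳ L₀)))

    -- Adding 2g·d·F_k to both sides lets lucas-via-fibonacci be used without subtraction.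
    Δ-fibonacci : ∀ k → Δ * F (suc k) ≈ d * L (suc k) + g * (2# * L k)
    Δ-fibonacci k = ∙-cancelʳ (g * (2# * (d * F k))) _ _ (begin
      Δ * F (suc k) + g * (2# * (d * F k))
        ≈⟨ solve 4 (λ d g x y → (d :* d :+ (con 2 :+ con 2) :* g) :* x :+ g :* (con 2 :* (d :* y))
                                := d :* (d :* x :+ g :* (con 2 :* y)) :+ g :* (con 2 :* (con 2 :* x)))
                   refl d g (F (suc k)) (F k) ⟩
      d * (d * F (suc k) + g * (2# * F k)) + g * (2# * (2# * F (suc k)))
        ≈⟨ +-cong (*-congˡ (lucas-suc-via-fibonacci k)) (*-congˡ (*-congˡ (lucas-via-fibonacci k))) ⟨
      d * L (suc k) + g * (2# * (L k + d * F k))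
        ≈⟨ solve 5 (λ d g u v y → d :* u :+ g :* (con 2 :* (v :+ d :* y))
                                  := d :* u :+ g :* (con 2 :* v) :+ g :* (con 2 :* (d :* y)))
                   refl d g (L (suc k)) (L k) (F k) ⟩
      d * L (suc k) + g * (2# * L k) + g * (2# * (d * F k)) ∎)

    Δ-fibonacci-cross : ∀ m n → Δ * F (suc (m ℕ.+ n)) ≈ cross L L m n
    Δ-fibonacci-cross m n = trans (Δ-fibonacci (m ℕ.+ n)) (sym (lucas-cross m n))

    lucas-addition : ∀ m n →
      L (suc (suc (m ℕ.+ n))) ≈ L (suc m) * L (suc n) + g * (L m * L n - L (m ℕ.+ n))
    lucas-addition m n = begin
      L (suc (suc k))                                      ≈⟨ x≈z//y _ _ _ shifted ⟩
      cross L L m n - g * L k                              ≈⟨ +-assoc _ _ _ ⟩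
      L (suc m) * L (suc n) + (g * (L m * L n) - g * L k)  ≈⟨ +-congˡ (x[y-z]≈xy-xz g _ _) ⟨
      L (suc m) * L (suc n) + g * (L m * L n - L k)        ∎
      where
      k : ℕ
      k = m ℕ.+ n
      shifted : L (suc (suc k)) + g * L k ≈ cross L L m n
      shifted = begin
        L (suc (suc k)) + g * L k              ≈⟨ +-congʳ (L-rec k) ⟩
        d * L (suc k) + g * L k + g * L k      ≈⟨ solve 4 (λ d g u v → d :* u :+ g :* v :+ g :* v
                                                                 := d :* u :+ g :* (con 2 :* v))
                                                           refl d g (L (suc k)) (L k) ⟩
        d * L (suc k) + g * (2# * L k)         ≈⟨ lucas-cross m n ⟨
        cross L L m n                          ∎

-- A record rather than _≈ₚ_ itself, so that the polynomials can be inferred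
-- from the type of a proof (the ring laws take them as implicit arguments).
infix 4 _≋_
record _≋_ (p q : Poly) : Set where
  constructor mk≋
  field coeff-≡ : p ≈ₚ q
open _≋_ public

≋-isEquivalence : IsEquivalence _≋_
≋-isEquivalence = record
  { refl  = mk≋ λ _ → ≡.refl
  ; sym   = λ (mk≋ e) → mk≋ λ i → ≡.sym (e i)
  ; trans = λ (mk≋ e) (mk≋ f) → mk≋ λ i → ≡.trans (e i) (f i)
  }

open IsEquivalence ≋-isEquivalence using ()
  renaming (refl to ≋-refl; sym to ≋-sym; trans to ≋-trans)

coeff-+ₚ : ∀ p q i → coeff (p +ₚ q) i ≡ coeff p i ℤ.+ coeff q i
coeff-+ₚ []      q       i       = ≡.sym (ℤ.+-identityˡ _)
coeff-+ₚ (a ∷ p) []      i       = ≡.sym (ℤ.+-identityʳ _)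
coeff-+ₚ (a ∷ p) (b ∷ q) zero    = ≡.refl
coeff-+ₚ (a ∷ p) (b ∷ q) (suc i) = coeff-+ₚ p q i

coeff-·ₚ : ∀ c p i → coeff (c ·ₚ p) i ≡ c ℤ.* coeff p i
coeff-·ₚ c []      i       = ≡.sym (ℤ.*-zeroʳ c)
coeff-·ₚ c (a ∷ p) zero    = ≡.refl
coeff-·ₚ c (a ∷ p) (suc i) = coeff-·ₚ c p i

∷-cong : ∀ {a b p q} → a ≡ b → p ≋ q → a ∷ p ≋ b ∷ q
∷-cong a≡b (mk≋ e) = mk≋ λ { zero → a≡b ; (suc i) → e i }

[0]≋0ₚ : 0ℤ ∷ [] ≋ 0ₚ
[0]≋0ₚ = mk≋ λ { zero → ≡.refl ; (suc i) → ≡.refl }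

+ₚ-cong : ∀ {p p′ q q′} → p ≋ p′ → q ≋ q′ → p +ₚ q ≋ p′ +ₚ q′
+ₚ-cong {p} {p′} {q} {q′} (mk≋ e) (mk≋ f) = mk≋ λ i →
  ≡.trans (coeff-+ₚ p q i) (≡.trans (≡.cong₂ ℤ._+_ (e i) (f i)) (≡.sym (coeff-+ₚ p′ q′ i)))

+ₚ-assoc : ∀ p q r → (p +ₚ q) +ₚ r ≋ p +ₚ (q +ₚ r)
+ₚ-assoc p q r = mk≋ λ i → begin
  coeff ((p +ₚ q) +ₚ r) i
    ≡⟨ ≡.trans (coeff-+ₚ (p +ₚ q) r i) (≡.cong (ℤ._+ coeff r i) (coeff-+ₚ p q i)) ⟩
  coeff p i ℤ.+ coeff q i ℤ.+ coeff r i
    ≡⟨ ℤ.+-assoc (coeff p i) (coeff q i) (coeff r i) ⟩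
  coeff p i ℤ.+ (coeff q i ℤ.+ coeff r i)
    ≡⟨ ≡.trans (coeff-+ₚ p (q +ₚ r) i) (≡.cong₂ ℤ._+_ (≡.refl {x = coeff p i}) (coeff-+ₚ q r i)) ⟨
  coeff (p +ₚ (q +ₚ r)) i ∎
  where open ≡.≡-Reasoning

+ₚ-comm : ∀ p q → p +ₚ q ≋ q +ₚ p
+ₚ-comm p q = mk≋ λ i →
  ≡.trans (coeff-+ₚ p q i) (≡.trans (ℤ.+-comm (coeff p i) (coeff q i)) (≡.sym (coeff-+ₚ q p i)))

+ₚ-identityʳ : ∀ p → p +ₚ 0ₚ ≋ p
+ₚ-identityʳ p = mk≋ λ i → ≡.trans (coeff-+ₚ p [] i) (ℤ.+-identityʳ (coeff p i))

negₚ-inverseˡ : ∀ p → negₚ p +ₚ p ≋ 0ₚ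
negₚ-inverseˡ p = mk≋ λ i → begin
  coeff (negₚ p +ₚ p) i
    ≡⟨ coeff-+ₚ (negₚ p) p i ⟩
  coeff (negₚ p) i ℤ.+ coeff p i
    ≡⟨ ≡.cong (ℤ._+ coeff p i) (≡.trans (coeff-·ₚ -1ℤ p i) (ℤ.-1*i≡-i (coeff p i))) ⟩
  ℤ.- coeff p i ℤ.+ coeff p i
    ≡⟨ ℤ.+-inverseˡ (coeff p i) ⟩
  0ℤ ∎
  where open ≡.≡-Reasoning

+ₚ-commutativeMonoid : CommutativeMonoid 0ℓ 0ℓ
+ₚ-commutativeMonoid = record
  { Carrier = Poly ; _≈_ = _≋_ ; _∙_ = _+ₚ_ ; ε = 0ₚ
  ; isCommutativeMonoid = record
    { isMonoid = record
      { isSemigroup = record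
        { isMagma = record { isEquivalence = ≋-isEquivalence ; ∙-cong = +ₚ-cong }
        ; assoc = +ₚ-assoc }
      ; identity = (λ _ → ≋-refl) , +ₚ-identityʳ }
    ; comm = +ₚ-comm } }

open import Algebra.Properties.CommutativeSemigroup (CommutativeMonoid.commutativeSemigroup +ₚ-commutativeMonoid)
  using (interchange; x∙yz≈y∙xz)

·ₚ-cong : ∀ c {p q} → p ≋ q → c ·ₚ p ≋ c ·ₚ q
·ₚ-cong c {p} {q} (mk≋ e) = mk≋ λ i →
  ≡.trans (coeff-·ₚ c p i) (≡.trans (≡.cong (c ℤ.*_) (e i)) (≡.sym (coeff-·ₚ c q i)))

·ₚ-distribˡ : ∀ c p q → c ·ₚ (p +ₚ q) ≋ c ·ₚ p +ₚ c ·ₚ q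
·ₚ-distribˡ c p q = mk≋ λ i → begin
  coeff (c ·ₚ (p +ₚ q)) i
    ≡⟨ ≡.trans (coeff-·ₚ c (p +ₚ q) i) (≡.cong (c ℤ.*_) (coeff-+ₚ p q i)) ⟩
  c ℤ.* (coeff p i ℤ.+ coeff q i)
    ≡⟨ ℤ.*-distribˡ-+ c (coeff p i) (coeff q i) ⟩
  c ℤ.* coeff p i ℤ.+ c ℤ.* coeff q i
    ≡⟨ ≡.trans (coeff-+ₚ (c ·ₚ p) (c ·ₚ q) i) (≡.cong₂ ℤ._+_ (coeff-·ₚ c p i) (coeff-·ₚ c q i)) ⟨
  coeff (c ·ₚ p +ₚ c ·ₚ q) i ∎
  where open ≡.≡-Reasoning

·ₚ-distribʳ : ∀ a b p → (a ℤ.+ b) ·ₚ p ≋ a ·ₚ p +ₚ b ·ₚ p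
·ₚ-distribʳ a b p = mk≋ λ i → begin
  coeff ((a ℤ.+ b) ·ₚ p) i
    ≡⟨ coeff-·ₚ (a ℤ.+ b) p i ⟩
  (a ℤ.+ b) ℤ.* coeff p i
    ≡⟨ ℤ.*-distribʳ-+ (coeff p i) a b ⟩
  a ℤ.* coeff p i ℤ.+ b ℤ.* coeff p i
    ≡⟨ ≡.trans (coeff-+ₚ (a ·ₚ p) (b ·ₚ p) i) (≡.cong₂ ℤ._+_ (coeff-·ₚ a p i) (coeff-·ₚ b p i)) ⟨
  coeff (a ·ₚ p +ₚ b ·ₚ p) i ∎
  where open ≡.≡-Reasoning

·ₚ-assoc : ∀ a b p → (a ℤ.* b) ·ₚ p ≋ a ·ₚ (b ·ₚ p)
·ₚ-assoc a b p = mk≋ λ i → begin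
  coeff ((a ℤ.* b) ·ₚ p) i    ≡⟨ coeff-·ₚ (a ℤ.* b) p i ⟩
  a ℤ.* b ℤ.* coeff p i       ≡⟨ ℤ.*-assoc a b (coeff p i) ⟩
  a ℤ.* (b ℤ.* coeff p i)
    ≡⟨ ≡.trans (coeff-·ₚ a (b ·ₚ p) i) (≡.cong (a ℤ.*_) (coeff-·ₚ b p i)) ⟨
  coeff (a ·ₚ (b ·ₚ p)) i     ∎
  where open ≡.≡-Reasoning

·ₚ-zeroˡ : ∀ p → 0ℤ ·ₚ p ≋ 0ₚ
·ₚ-zeroˡ p = mk≋ (coeff-·ₚ 0ℤ p)

·ₚ-identityˡ : ∀ p → 1ℤ ·ₚ p ≋ p
·ₚ-identityˡ p = mk≋ λ i → ≡.trans (coeff-·ₚ 1ℤ p i) (ℤ.*-identityˡ (coeff p i))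

*ₚ-congʳ : ∀ p {q q′} → q ≋ q′ → p *ₚ q ≋ p *ₚ q′
*ₚ-congʳ []      q≋q′ = ≋-refl
*ₚ-congʳ (a ∷ p) q≋q′ = +ₚ-cong (·ₚ-cong a q≋q′) (∷-cong ≡.refl (*ₚ-congʳ p q≋q′))

*ₚ-zeroʳ : ∀ p → p *ₚ 0ₚ ≋ 0ₚ
*ₚ-zeroʳ []      = ≋-refl
*ₚ-zeroʳ (a ∷ p) = ≋-trans (∷-cong ≡.refl (*ₚ-zeroʳ p)) [0]≋0ₚ

*ₚ-∷ʳ : ∀ p b q → p *ₚ (b ∷ q) ≋ b ·ₚ p +ₚ (0ℤ ∷ p *ₚ q)
*ₚ-∷ʳ []      b q = ≋-sym [0]≋0ₚ
*ₚ-∷ʳ (a ∷ p) b q = ∷-cong (≡.cong₂ ℤ._+_ (ℤ.*-comm a b) ≡.refl)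
  (≋-trans (+ₚ-cong ≋-refl (*ₚ-∷ʳ p b q)) (x∙yz≈y∙xz (a ·ₚ q) (b ·ₚ p) (0ℤ ∷ p *ₚ q)))

*ₚ-comm : ∀ p q → p *ₚ q ≋ q *ₚ p
*ₚ-comm []      q = ≋-sym (*ₚ-zeroʳ q)
*ₚ-comm (a ∷ p) q = ≋-trans (+ₚ-cong ≋-refl (∷-cong ≡.refl (*ₚ-comm p q))) (≋-sym (*ₚ-∷ʳ q a p))

*ₚ-cong : ∀ {p p′ q q′} → p ≋ p′ → q ≋ q′ → p *ₚ q ≋ p′ *ₚ q′
*ₚ-cong {p} {p′} {q} {q′} p≋p′ q≋q′ =
  ≋-trans (*ₚ-comm p q) (≋-trans (*ₚ-congʳ q p≋p′) (≋-trans (*ₚ-comm q p′) (*ₚ-congʳ p′ q≋q′)))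

·ₚ-*ₚ : ∀ c p q → (c ·ₚ p) *ₚ q ≋ c ·ₚ (p *ₚ q)
·ₚ-*ₚ c []      q = ≋-refl
·ₚ-*ₚ c (a ∷ p) q = ≋-trans
  (+ₚ-cong (·ₚ-assoc c a q) (∷-cong (≡.sym (ℤ.*-zeroʳ c)) (·ₚ-*ₚ c p q)))
  (≋-sym (·ₚ-distribˡ c (a ·ₚ q) (0ℤ ∷ p *ₚ q)))

*ₚ-distribʳ : ∀ r p q → (p +ₚ q) *ₚ r ≋ p *ₚ r +ₚ q *ₚ r
*ₚ-distribʳ r []      q       = ≋-refl
*ₚ-distribʳ r (a ∷ p) []      = ≋-sym (+ₚ-identityʳ _)
*ₚ-distribʳ r (a ∷ p) (b ∷ q) = ≋-trans
  (+ₚ-cong (·ₚ-distribʳ a b r) (∷-cong ≡.refl (*ₚ-distribʳ r p q)))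
  (interchange (a ·ₚ r) (b ·ₚ r) (0ℤ ∷ p *ₚ r) (0ℤ ∷ q *ₚ r))

*ₚ-distribˡ : ∀ r p q → r *ₚ (p +ₚ q) ≋ r *ₚ p +ₚ r *ₚ q
*ₚ-distribˡ r p q = ≋-trans (*ₚ-comm r (p +ₚ q))
  (≋-trans (*ₚ-distribʳ r p q) (+ₚ-cong (*ₚ-comm p r) (*ₚ-comm q r)))

*ₚ-assoc : ∀ p q r → (p *ₚ q) *ₚ r ≋ p *ₚ (q *ₚ r)
*ₚ-assoc []      q r = ≋-refl
*ₚ-assoc (a ∷ p) q r = ≋-trans (*ₚ-distribʳ r (a ·ₚ q) (0ℤ ∷ p *ₚ q))
  (+ₚ-cong (·ₚ-*ₚ a q r) (+ₚ-cong (·ₚ-zeroˡ r) (∷-cong ≡.refl (*ₚ-assoc p q r))))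

*ₚ-identityˡ : ∀ p → 1ₚ *ₚ p ≋ p
*ₚ-identityˡ p = ≋-trans (+ₚ-cong (·ₚ-identityˡ p) [0]≋0ₚ) (+ₚ-identityʳ p)

*ₚ-identityʳ : ∀ p → p *ₚ 1ₚ ≋ p
*ₚ-identityʳ p = ≋-trans (*ₚ-comm p 1ₚ) (*ₚ-identityˡ p)

ℤ[x] : CommutativeRing 0ℓ 0ℓ
ℤ[x] = record
  { Carrier = Poly ; _≈_ = _≋_ ; _+_ = _+ₚ_ ; _*_ = _*ₚ_ ; -_ = negₚ ; 0# = 0ₚ ; 1# = 1ₚ
  ; isCommutativeRing = record
    { isRing = record
      { +-isAbelianGroup = record
        { isGroup = record
          { isMonoid = CommutativeMonoid.isMonoid +ₚ-commutativeMonoid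
          ; inverse  = negₚ-inverseˡ , λ p → ≋-trans (+ₚ-comm p (negₚ p)) (negₚ-inverseˡ p)
          ; ⁻¹-cong  = ·ₚ-cong -1ℤ }
        ; comm = +ₚ-comm }
      ; *-cong     = *ₚ-cong
      ; *-assoc    = *ₚ-assoc
      ; *-identity = *ₚ-identityˡ , *ₚ-identityʳ
      ; distrib    = *ₚ-distribˡ , *ₚ-distribʳ }
    ; *-comm = *ₚ-comm } }

·ₚ≋const*ₚ : ∀ c p → c ·ₚ p ≋ const c *ₚ p
·ₚ≋const*ₚ c p = ≋-sym (≋-trans (+ₚ-cong ≋-refl [0]≋0ₚ) (+ₚ-identityʳ (c ·ₚ p)))

const-*ₚ : ∀ a b → const a *ₚ const b ≋ const (a ℤ.* b)
const-*ₚ a b = mk≋ λ { zero → ℤ.+-identityʳ (a ℤ.* b) ; (suc i) → ≡.refl }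

·ₚ-cancelˡ : ∀ c {p q} → c ≢ 0ℤ → c ·ₚ p ≋ c ·ₚ q → p ≋ q
·ₚ-cancelˡ c {p} {q} c≢0 (mk≋ e) = mk≋ λ i →
  ℤ.*-cancelˡ-≡ c (coeff p i) (coeff q i) {{ℤ.≢-nonZero c≢0}}
    (≡.trans (≡.sym (coeff-·ₚ c p i)) (≡.trans (e i) (coeff-·ₚ c q i)))

module LucasPolynomials (d g : Poly) (p₀ α : ℤ) (p₁ : Poly)
  (α*p₀≡2 : α *ℤ p₀ ≡ + 2) (2p₁≈p₀d : (+ 2) ·ₚ p₁ ≈ₚ p₀ ·ₚ d) where

  open CommutativeRing ℤ[x] using (commutativeSemiring; setoid; ring; refl)
  open Recurrence ℤ[x] d g
  open import Algebra.Properties.Ring ring using (x[y-z]≈xy-xz)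
  open import Algebra.Solver.Ring.NaturalCoefficients.Default commutativeSemiring
  open import Relation.Binary.Reasoning.Setoid setoid

  A : Poly
  A = const α

  G F L : ℕ → Poly
  G = GLucas d g p₀ p₁
  F = GFib d g
  L k = A *ₚ G k

  L-recurrent : Recurrent L
  L-recurrent = *-recurrent A {G} (λ _ → ≋-refl)

  F-recurrent : Recurrent F
  F-recurrent _ = ≋-refl

  L₀ : L 0 ≋ 2#
  L₀ = ≋-trans (const-*ₚ α p₀) (mk≋ λ { zero → α*p₀≡2 ; (suc i) → ≡.refl })

  L₁ : L 1 ≋ d
  L₁ = ·ₚ-cancelˡ (+ 2) (λ ()) (begin
    (+ 2) ·ₚ (A *ₚ p₁)   ≈⟨ ·ₚ-cong (+ 2) (·ₚ≋const*ₚ α p₁) ⟨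
    (+ 2) ·ₚ (α ·ₚ p₁)   ≈⟨ ·ₚ-assoc (+ 2) α p₁ ⟨
    (+ 2 *ℤ α) ·ₚ p₁     ≡⟨ ≡.cong (_·ₚ p₁) (ℤ.*-comm (+ 2) α) ⟩
    (α *ℤ + 2) ·ₚ p₁     ≈⟨ ·ₚ-assoc α (+ 2) p₁ ⟩
    α ·ₚ ((+ 2) ·ₚ p₁)   ≈⟨ ·ₚ-cong α (mk≋ 2p₁≈p₀d) ⟩
    α ·ₚ (p₀ ·ₚ d)       ≈⟨ ·ₚ-assoc α p₀ d ⟨
    (α *ℤ p₀) ·ₚ d       ≡⟨ ≡.cong (_·ₚ d) α*p₀≡2 ⟩
    (+ 2) ·ₚ d           ∎)

  open LucasFibonacci L-recurrent F-recurrent L₀ L₁ ≋-refl ≋-refl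

  α≢0 : α ≢ 0ℤ
  α≢0 α≡0 with ≡.trans (≡.sym α*p₀≡2) (≡.cong (_*ℤ p₀) α≡0)
  ... | ()

  fibonacci-product-formula : ∀ m n → (d *ₚ d +ₚ (+ 4) ·ₚ g) *ₚ F (suc (m ℕ.+ n))
    ≋ (α *ℤ α) ·ₚ (G (suc m) *ₚ G (suc n)) +ₚ (α *ℤ α) ·ₚ (g *ₚ G m *ₚ G n)
  fibonacci-product-formula m n = begin
    (d *ₚ d +ₚ (+ 4) ·ₚ g) *ₚ F (suc k)
      ≈⟨ *ₚ-cong (+ₚ-cong (≋-refl {d *ₚ d}) (·ₚ≋const*ₚ (+ 4) g)) (≋-refl {F (suc k)}) ⟩
    Δ *ₚ F (suc k)
      ≈⟨ Δ-fibonacci-cross m n ⟩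
    cross L L m n
      ≈⟨ solve 6 (λ a g x y u v → a :* x :* (a :* y) :+ g :* (a :* u :* (a :* v))
                                   := a :* a :* (x :* y) :+ a :* a :* (g :* u :* v))
                 refl A g (G (suc m)) (G (suc n)) (G m) (G n) ⟩
    (A *ₚ A) *ₚ (G (suc m) *ₚ G (suc n)) +ₚ (A *ₚ A) *ₚ (g *ₚ G m *ₚ G n)
      ≈⟨ +ₚ-cong (scale-α² (G (suc m) *ₚ G (suc n))) (scale-α² (g *ₚ G m *ₚ G n)) ⟨
    (α *ℤ α) ·ₚ (G (suc m) *ₚ G (suc n)) +ₚ (α *ℤ α) ·ₚ (g *ₚ G m *ₚ G n) ∎
    where
    k : ℕ
    k = m ℕ.+ n
    scale-α² : ∀ p → (α *ℤ α) ·ₚ p ≋ (A *ₚ A) *ₚ p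
    scale-α² p = ≋-trans (·ₚ≋const*ₚ (α *ℤ α) p) (*ₚ-cong (≋-sym (const-*ₚ α α)) ≋-refl)

  lucas-product-formula : ∀ m n → G (suc (suc (m ℕ.+ n)))
    ≋ α ·ₚ (G (suc m) *ₚ G (suc n)) +ₚ g *ₚ (α ·ₚ (G m *ₚ G n) -ₚ G (m ℕ.+ n))
  lucas-product-formula m n = ·ₚ-cancelˡ α α≢0 (begin
    α ·ₚ G (suc (suc k))
      ≈⟨ ·ₚ≋const*ₚ α (G (suc (suc k))) ⟩
    L (suc (suc k))
      ≈⟨ lucas-addition m n ⟩
    L (suc m) *ₚ L (suc n) +ₚ g *ₚ (L m *ₚ L n -ₚ L k)
      ≈⟨ +ₚ-cong ≋-refl (*ₚ-congʳ g factor-A) ⟩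
    L (suc m) *ₚ L (suc n) +ₚ g *ₚ (A *ₚ (A *ₚ Q -ₚ G k))
      ≈⟨ solve 5 (λ a g x y w → a :* x :* (a :* y) :+ g :* (a :* w) := a :* (a :* (x :* y) :+ g :* w))
                 refl A g (G (suc m)) (G (suc n)) (A *ₚ Q -ₚ G k) ⟩
    A *ₚ (A *ₚ P +ₚ g *ₚ (A *ₚ Q -ₚ G k))
      ≈⟨ *ₚ-congʳ A (+ₚ-cong (·ₚ≋const*ₚ α P)
                             (*ₚ-congʳ g (+ₚ-cong (·ₚ≋const*ₚ α Q) (≋-refl {negₚ (G k)})))) ⟨
    A *ₚ (α ·ₚ P +ₚ g *ₚ (α ·ₚ Q -ₚ G k))
      ≈⟨ ·ₚ≋const*ₚ α (α ·ₚ P +ₚ g *ₚ (α ·ₚ Q -ₚ G k)) ⟨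
    α ·ₚ (α ·ₚ P +ₚ g *ₚ (α ·ₚ Q -ₚ G k)) ∎)
    where
    k : ℕ
    k = m ℕ.+ n
    P Q : Poly
    P = G (suc m) *ₚ G (suc n)
    Q = G m *ₚ G n
    factor-A : L m *ₚ L n -ₚ L k ≋ A *ₚ (A *ₚ Q -ₚ G k)
    factor-A = ≋-trans
      (+ₚ-cong {q = negₚ (L k)}
        (solve 3 (λ a u v → a :* u :* (a :* v) := a :* (a :* (u :* v))) refl A (G m) (G n)) ≋-refl)
      (≋-sym (x[y-z]≈xy-xz A (A *ₚ Q) (G k)))

open import Data.Nat using (_+_)

proposition6 : (d g : Poly) (p₀ : ℤ) (p₁ : Poly) →
    Admissible d g → LucasType d g p₀ p₁ →
    (α : ℤ) → α *ℤ p₀ ≡ + 2 →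
    (m n : ℕ) →
    ((d *ₚ d +ₚ (+ 4) ·ₚ g) *ₚ GFib d g (suc (m + n))
      ≈ₚ (α *ℤ α) ·ₚ (GLucas d g p₀ p₁ (suc m) *ₚ GLucas d g p₀ p₁ (suc n))
         +ₚ (α *ℤ α) ·ₚ (g *ₚ GLucas d g p₀ p₁ m *ₚ GLucas d g p₀ p₁ n))
    ×
    (GLucas d g p₀ p₁ (suc (suc (m + n)))
      ≈ₚ α ·ₚ (GLucas d g p₀ p₁ (suc m) *ₚ GLucas d g p₀ p₁ (suc n))
         +ₚ g *ₚ (α ·ₚ (GLucas d g p₀ p₁ m *ₚ GLucas d g p₀ p₁ n) -ₚ GLucas d g p₀ p₁ (m + n)))
proposition6 d g p₀ p₁ _ (_ , _ , 2p₁≈p₀d , _) α α*p₀≡2 m n =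
  coeff-≡ (fibonacci-product-formula m n) , coeff-≡ (lucas-product-formula m n)
  where open LucasPolynomials d g p₀ α p₁ α*p₀≡2 2p₁≈p₀d
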